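{- Let $m\ge2$ and let the maps $\varphi^{(n)}$ be as defined in the context. For all $n\ge i\ge1$ and all $(v_1,\dots,v_n)\in\{0,\dots,m-1\}^n$, the $i$-th coordinate of $\varphi^{(n)}(v_1,\dots,v_n)$ equals the $i$-th coordinate of $\varphi^{(i)}(v_1,\dots,v_i)$.
   Context: Fix $m\ge2$ and work with residues mod $m$ in $\{0,\dots,m-1\}$. Define maps $\varphi^{(n)}:\{0,\dots,m-1\}^n\to\{0,\dots,m-1\}^n$ recursively: $\varphi^{(1)}$ is the identity, and for $n\ge2$, $\varphi^{(n)}(v_1,v_2,\dots,v_n)=\bigl(v_1,\ \varphi^{(n-1)}((v_1+v_2)\bmod m,(v_1+v_3)\bmod m,\dots,(v_1+v_n)\bmod m)\bigr)$. (This is the map carrying the Sierpinski graph $S(n,m)$ onto a subgraph of the Hamming graph $K_m^n$.) -}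

module Defs where

open import Data.Nat using (ℕ; zero; suc; _+_; NonZero)
open import Data.Nat.DivMod using (_mod_)
open import Data.Fin using (Fin; toℕ)
open import Data.Vec using (Vec; []; _∷_; map)

_+ₘ_ : ∀ {m} .{{_ : NonZero m}} → Fin m → Fin m → Fin m
_+ₘ_ {m} a b = (toℕ a + toℕ b) mod m

-- φ⁽ⁿ⁾ for n ≥ 1, written φ m n acting on vectors of length suc n (= paper's n+1).
-- φ⁽¹⁾ = id;  φ⁽ⁿ⁾(v₁,…,vₙ) = (v₁, φ⁽ⁿ⁻¹⁾(v₁+v₂, …, v₁+vₙ)).
φ : ∀ (m : ℕ) .{{_ : NonZero m}} (n : ℕ) → Vec (Fin m) (suc n) → Vec (Fin m) (suc n)
φ m zero    (v ∷ [])     = v ∷ []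
φ m (suc n) (v₁ ∷ rest)  = v₁ ∷ φ m n (map (v₁ +ₘ_) rest)

-- Coordinate i of φ⁽ⁿ⁾ sees only v₁,…,vᵢ: each unfolding of φ fixes the first
-- coordinate and recurses on a vector obtained coordinatewise by adding v₁, and
-- adding v₁ commutes with truncating to the first i entries.
module Submission where

open import Defs
open import Data.Nat using (ℕ; zero; suc; _+_; _≤_; NonZero)
open import Data.Fin using (Fin; fromℕ; _↑ˡ_)
open import Data.Vec using (Vec; []; _∷_; lookup; take; map)
open import Data.Vec.Properties using (take-map)
open import Relation.Binary.PropositionalEquality using (_≡_; refl; cong; trans)

lookup-φ-zero : (m : ℕ) .{{_ : NonZero m}} (n : ℕ) (x : Fin m) (xs : Vec (Fin m) n) →
  lookup (φ m n (x ∷ xs)) Fin.zero ≡ x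
lookup-φ-zero m zero    x [] = refl
lookup-φ-zero m (suc n) x xs = refl

lookup-φ-take : (m : ℕ) .{{_ : NonZero m}} (i k : ℕ) (v : Vec (Fin m) (suc i + k)) →
  lookup (φ m (i + k) v) (fromℕ i ↑ˡ k) ≡ lookup (φ m i (take (suc i) v)) (fromℕ i)
lookup-φ-take m zero    k (x ∷ xs) = lookup-φ-zero m k x xs
lookup-φ-take m (suc i) k (x ∷ xs) =
  trans (lookup-φ-take m i k (map (x +ₘ_) xs))
        (cong (λ w → lookup (φ m i w) (fromℕ i)) (take-map (x +ₘ_) (suc i) xs))

lemma2 : (m : ℕ) → 2 ≤ m → .{{_ : NonZero m}} → (i k : ℕ) → (v : Vec (Fin m) (suc i + k)) →
    lookup (φ m (i + k) v) (fromℕ i ↑ˡ k) ≡ lookup (φ m i (take (suc i) v)) (fromℕ i)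
lemma2 m _ = lookup-φ-take m
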